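{- Let $f$ and $g$ be as defined in the context. Then: (1) $f(n,a)\le f(n+1,a)$ for all $a,n\in\mathbb{N}^+$ with $n\ge\lceil\log_2 a\rceil+1$. (2) $g(n,m)\ge g(n+1,m)$ for all $m,n\in\mathbb{N}^+$ with $n\ge\lceil\log_2 m\rceil$. (3) $f(n,a)<f(n,a+1)$ for all $a,n\in\mathbb{N}^+$ with $n>\lceil\log_2 a\rceil+1$. (4) $g(n,m)\le g(n,m+1)$ for all $m,n\in\mathbb{N}^+$ with $n\ge\lceil\log_2 m\rceil$. (5) $g(n,f(n,a))=a$ for all $a,n\in\mathbb{N}^+$ with $n>\lceil\log_2 a\rceil+1$. (6) $f(n,g(n,m))\ge m$ for all $m,n\in\mathbb{N}^+$ with $n\ge\lceil\log_2 m\rceil$.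
   Context: A family $\mathcal{F}$ on ground set $[n]=\{1,\dots,n\}$ is a collection $\mathcal{S}(\mathcal{F})$ of distinct subsets of $[n]$ (elements of $[n]$ may lie in no set); $n(\mathcal{F})=n$ and $m(\mathcal{F})=|\mathcal{S}(\mathcal{F})|$. It is union-closed if $S\cup T\in\mathcal{S}(\mathcal{F})$ whenever $S,T\in\mathcal{S}(\mathcal{F})$. For $e\in[n]$, $m_e(\mathcal{F})$ is the number of sets of $\mathcal{F}$ containing $e$, and the degree is $a(\mathcal{F})=\max_{e\in[n]}m_e(\mathcal{F})$. For $n,a\in\mathbb{N}^+$, $f(n,a)$ is the maximum of $m(\mathcal{F})$ over all union-closed families $\mathcal{F}$ on ground set $[n]$ with $\mathcal{S}(\mathcal{F})\neq\emptyset$ and $a(\mathcal{F})\le a$. For $n,m\in\mathbb{N}^+$ with $m\ge2$, $g(n,m)$ is the minimum of $a(\mathcal{F})$ over all union-closed families $\mathcal{F}$ on ground set $[n]$ with $m(\mathcal{F})=m$ (defined when such a family exists, i.e. $m\le 2^n$). -}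

module Defs where

open import Data.Nat using (ℕ; _≤_; _⊔_)
open import Data.List using (List; []; length; filter; foldr)
open import Data.List.Relation.Unary.Unique.Propositional using (Unique)
open import Data.List.Membership.Propositional renaming (_∈_ to _∈ₗ_)
open import Data.Fin using (Fin)
open import Data.Fin.Subset using (Subset; _∪_)
open import Data.Fin.Subset.Properties using (_∈?_)
open import Data.List using (allFin) public
open import Data.Product using (Σ; _×_)
open import Relation.Binary.PropositionalEquality using (_≡_; _≢_)

-- A family on ground set [n] is a list of subsets of Fin n; it is a genuine
-- family (collection of *distinct* sets) when the list has no duplicates.
Family : ℕ → Set
Family n = List (Subset n)

m : ∀ {n} → Family n → ℕ
m F = length F

UnionClosed : ∀ {n} → Family n → Set
UnionClosed F = ∀ {S T} → S ∈ₗ F → T ∈ₗ F → (S ∪ T) ∈ₗ F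

mₑ : ∀ {n} → Fin n → Family n → ℕ
mₑ e F = length (filter (e ∈?_) F)

-- a(F) = max over e ∈ [n] of m_e(F)
degree : ∀ {n} → Family n → ℕ
degree {n} F = foldr (λ e acc → mₑ e F ⊔ acc) 0 (allFin n)

UCFamily : ∀ {n} → Family n → Set
UCFamily F = Unique F × UnionClosed F

-- IsF n a k : k = f(n,a), the maximum of m(F) over union-closed families F on [n]
-- with S(F) nonempty and a(F) ≤ a.
IsF : ℕ → ℕ → ℕ → Set
IsF n a k =
  Σ (Family n) (λ F → UCFamily F × F ≢ [] × degree F ≤ a × m F ≡ k)
  × (∀ (F : Family n) → UCFamily F → F ≢ [] → degree F ≤ a → m F ≤ k)

-- IsG n M j : M ≥ 2 and j = g(n,M), the minimum of a(F) over union-closed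
-- families F on [n] with m(F) = M.  (No such j exists when g(n,M) is undefined.)
IsG : ℕ → ℕ → ℕ → Set
IsG n M j =
  2 ≤ M
  × Σ (Family n) (λ F → UCFamily F × m F ≡ M × degree F ≡ j)
  × (∀ (F : Family n) → UCFamily F → m F ≡ M → j ≤ degree F)

-- Parts (1), (2) and (6) compare a family with itself or with its copy on a
-- larger ground set.  For (4), deleting a set of minimum size from a family
-- realising g(n, m+1) keeps it union-closed, since no union of two remaining
-- sets can equal the deleted one.  Parts (3) and (5) use the converse move: a
-- union-closed family on [n+1] of degree less than 2^n misses some set
-- containing the first element, and a maximal set among the non-members can
-- be added to the family keeping it union-closed while raising the degree by
-- at most one.  The hypothesis n > ⌈log₂ a⌉ + 1 guarantees a < 2^(n-1).
module Submission where

open import Defs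
open import Data.Nat using (ℕ; zero; suc; _+_; _≤_; _<_; _≥_; _>_; _⊔_; _^_; z≤n; s≤s)
open import Data.Nat.Properties
open import Data.Nat.Logarithm using (⌈log₂_⌉; ⌈log₂⌉-mono-≤; ⌈log₂2^n⌉≡n)
open import Data.Bool using (true; false)
import Data.Bool as Bool
open import Data.List using (List; []; _∷_; length; filter; foldr; map; _++_)
open import Data.List.Properties using (length-map; length-++; filter-notAll; filter-accept; filter-reject; filter-all)
open import Data.List.Relation.Unary.All as All using (All; []; _∷_)
open import Data.List.Relation.Unary.All.Properties.Core using (¬All⇒Any¬)
import Data.List.Relation.Unary.Any as Any
open import Data.List.Relation.Unary.Any using (here; there)
open import Data.List.Relation.Unary.AllPairs using ([]; _∷_)
open import Data.List.Relation.Unary.Unique.Propositional using (Unique)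
import Data.List.Relation.Unary.Unique.Propositional.Properties as Unique
open import Data.List.Membership.Propositional using (_∈_; _∉_; find)
open import Data.List.Membership.Propositional.Properties
  using (∈-map⁺; ∈-map⁻; ∈-filter⁺; ∈-filter⁻; ∈-allFin)
import Data.List.Membership.DecPropositional as DecMembership
import Data.List.Extrema.Nat as Extrema
open import Data.Fin using (Fin; zero; suc)
open import Data.Fin.Properties using (any?)
open import Data.Fin.Subset using (Subset; _∪_; inside; outside; ∣_∣; _⊆_; _⊂_; _⊃_)
open import Data.Fin.Subset.Properties
  using (p⊆p∪q; ∪-comm; ∪-idem; ⊆-antisym; p⊂q⇒∣p∣<∣q∣) renaming (_∈?_ to _∈ₛ?_)
open import Data.Fin.Subset.Induction using (⊃-wellFounded; Acc; acc)
open import Data.Vec using ([]; _∷_; here)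
open import Data.Vec.Properties using (∷-injectiveʳ; ≡-dec)
open import Data.Empty using (⊥)
open import Data.Product using (∃; _×_; _,_; proj₁)
open import Relation.Nullary using (¬_; yes; no; does; contradiction; ¬?; _×-dec_)
open import Relation.Nullary.Decidable using (decidable-stable)
open import Relation.Binary.Definitions using (DecidableEquality)
open import Relation.Binary.PropositionalEquality

module Deletion {A : Set} (_≟_ : DecidableEquality A) where

  infixl 5 _∖_
  _∖_ : List A → A → List A
  xs ∖ x = filter (λ y → ¬? (y ≟ x)) xs

  ∈-∖⁺ : ∀ {x y xs} → y ∈ xs → y ≢ x → y ∈ xs ∖ x
  ∈-∖⁺ {x} = ∈-filter⁺ (λ y → ¬? (y ≟ x))

  ∈-∖⁻ : ∀ {x y xs} → y ∈ xs ∖ x → y ∈ xs × y ≢ x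
  ∈-∖⁻ {x} = ∈-filter⁻ (λ y → ¬? (y ≟ x))

  Unique-∖ : ∀ {x xs} → Unique xs → Unique (xs ∖ x)
  Unique-∖ {x} = Unique.filter⁺ (λ y → ¬? (y ≟ x))

  length-∖ : ∀ {x xs} → Unique xs → x ∈ xs → suc (length (xs ∖ x)) ≡ length xs
  length-∖ {x} {x ∷ xs} (x∉xs ∷ _) (here refl) =
    cong (λ ys → suc (length ys)) (begin
      (x ∷ xs) ∖ x ≡⟨ filter-reject (λ y → ¬? (y ≟ x)) (λ x≢x → x≢x refl) ⟩
      xs ∖ x       ≡⟨ filter-all (λ y → ¬? (y ≟ x)) (All.map (λ x≢y y≡x → x≢y (sym y≡x)) x∉xs) ⟩
      xs           ∎)
    where open ≡-Reasoning
  length-∖ {x} {y ∷ xs} (y∉xs ∷ u) (there x∈xs) = begin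
    suc (length ((y ∷ xs) ∖ x))
      ≡⟨ cong (λ ys → suc (length ys)) (filter-accept (λ z → ¬? (z ≟ x)) (All.lookup y∉xs x∈xs)) ⟩
    suc (suc (length (xs ∖ x)))
      ≡⟨ cong suc (length-∖ u x∈xs) ⟩
    suc (length xs) ∎
    where open ≡-Reasoning

  unique-⊆⇒length≤ : ∀ {xs ys : List A} → Unique xs → (∀ {x} → x ∈ xs → x ∈ ys) →
                     length xs ≤ length ys
  unique-⊆⇒length≤ {[]} _ _ = z≤n
  unique-⊆⇒length≤ {x ∷ xs} {ys} (x∉xs ∷ u) xs⊆ys = ≤-<-trans
    (unique-⊆⇒length≤ u λ y∈xs → ∈-∖⁺ (xs⊆ys (there y∈xs)) (λ y≡x → All.lookup x∉xs y∈xs (sym y≡x)))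
    (filter-notAll (λ y → ¬? (y ≟ x)) ys (Any.map (λ x≡y y≢x → y≢x (sym x≡y)) (xs⊆ys (here refl))))

_≟ₛ_ : ∀ {n} → DecidableEquality (Subset n)
_≟ₛ_ = ≡-dec Bool._≟_

module _ {n : ℕ} where
  open Deletion (_≟ₛ_ {n}) public
  open DecMembership (_≟ₛ_ {n}) public using (_∈?_)

⊆∧≢⇒⊂ : ∀ {n} {p q : Subset n} → p ⊆ q → p ≢ q → p ⊂ q
⊆∧≢⇒⊂ {p = p} {q} p⊆q p≢q with any? (λ x → (x ∈ₛ? q) ×-dec ¬? (x ∈ₛ? p))
... | yes (x , x∈q , x∉p) = p⊆q , x , x∈q , x∉p
... | no ∄ = contradiction (⊆-antisym p⊆q q⊆p) p≢q
  where
  q⊆p : q ⊆ p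
  q⊆p {x} x∈q = decidable-stable (x ∈ₛ? p) (λ x∉p → ∄ (x , x∈q , x∉p))

module _ {A : Set} (g : A → ℕ) where

  foldr-⊔-upperBound : ∀ {x} (xs : List A) → x ∈ xs → g x ≤ foldr (λ y acc → g y ⊔ acc) 0 xs
  foldr-⊔-upperBound (_ ∷ _) (here refl) = m≤m⊔n _ _
  foldr-⊔-upperBound (_ ∷ xs) (there x∈xs) = ≤-trans (foldr-⊔-upperBound xs x∈xs) (m≤n⊔m _ _)

  foldr-⊔-least : ∀ {a} (xs : List A) → (∀ x → g x ≤ a) → foldr (λ y acc → g y ⊔ acc) 0 xs ≤ a
  foldr-⊔-least [] _ = z≤n
  foldr-⊔-least (x ∷ xs) g≤a = ⊔-lub (g≤a x) (foldr-⊔-least xs g≤a)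

mₑ≤degree : ∀ {n} (e : Fin n) (F : Family n) → mₑ e F ≤ degree F
mₑ≤degree {n} e F = foldr-⊔-upperBound (λ e → mₑ e F) (allFin n) (∈-allFin e)

degree-least : ∀ {n} (F : Family n) {a} → (∀ e → mₑ e F ≤ a) → degree F ≤ a
degree-least {n} F = foldr-⊔-least (λ e → mₑ e F) (allFin n)

mₑ-∷ : ∀ {n} (e : Fin n) (S : Subset n) (F : Family n) → mₑ e (S ∷ F) ≤ suc (mₑ e F)
mₑ-∷ e S F with does (e ∈ₛ? S)
... | true  = ≤-refl
... | false = n≤1+n _

degree-∷ : ∀ {n} (S : Subset n) (F : Family n) → degree (S ∷ F) ≤ suc (degree F)
degree-∷ S F = degree-least (S ∷ F) λ e → ≤-trans (mₑ-∷ e S F) (s≤s (mₑ≤degree e F))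

degree-mono : ∀ {n} {R F : Family n} → Unique R → (∀ {S} → S ∈ R → S ∈ F) → degree R ≤ degree F
degree-mono {R = R} {F} uniqueR R⊆F = degree-least R λ e →
  ≤-trans (unique-⊆⇒length≤ (Unique.filter⁺ (e ∈ₛ?_) uniqueR) (filter-⊆ e)) (mₑ≤degree e F)
  where
  filter-⊆ : ∀ e {S} → S ∈ filter (e ∈ₛ?_) R → S ∈ filter (e ∈ₛ?_) F
  filter-⊆ e S∈ with ∈-filter⁻ (e ∈ₛ?_) S∈
  ... | S∈R , e∈S = ∈-filter⁺ (e ∈ₛ?_) (R⊆F S∈R) e∈S

embed : ∀ {n} → Family n → Family (suc n)
embed = map (outside ∷_)

embed-UCFamily : ∀ {n} {F : Family n} → UCFamily F → UCFamily (embed F)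
embed-UCFamily {F = F} (uniqueF , closedF) = Unique.map⁺ ∷-injectiveʳ uniqueF , closed
  where
  closed : UnionClosed (embed F)
  closed S∈ T∈ with ∈-map⁻ (outside ∷_) S∈ | ∈-map⁻ (outside ∷_) T∈
  ... | _ , S∈F , refl | _ , T∈F , refl = ∈-map⁺ (outside ∷_) (closedF S∈F T∈F)

embed-≢[] : ∀ {n} {F : Family n} → F ≢ [] → embed F ≢ []
embed-≢[] {F = []} F≢[] = contradiction refl F≢[]
embed-≢[] {F = _ ∷ _} _ = λ ()

mₑ-embed-zero : ∀ {n} (F : Family n) → mₑ zero (embed F) ≡ 0
mₑ-embed-zero [] = refl
mₑ-embed-zero (_ ∷ F) = mₑ-embed-zero F

mₑ-embed-suc : ∀ {n} (e : Fin n) (F : Family n) → mₑ (suc e) (embed F) ≡ mₑ e F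
mₑ-embed-suc e [] = refl
mₑ-embed-suc e (S ∷ F) with does (e ∈ₛ? S)
... | true  = cong suc (mₑ-embed-suc e F)
... | false = mₑ-embed-suc e F

degree-embed : ∀ {n} (F : Family n) → degree (embed F) ≤ degree F
degree-embed F = degree-least (embed F) λ where
  zero    → ≤-trans (≤-reflexive (mₑ-embed-zero F)) z≤n
  (suc e) → ≤-trans (≤-reflexive (mₑ-embed-suc e F)) (mₑ≤degree e F)

allSubsets : ∀ n → List (Subset n)
allSubsets zero = [] ∷ []
allSubsets (suc n) = map (outside ∷_) (allSubsets n) ++ map (inside ∷_) (allSubsets n)

length-allSubsets : ∀ n → length (allSubsets n) ≡ 2 ^ n
length-allSubsets zero = refl
length-allSubsets (suc n) = begin
  length (map (outside ∷_) (allSubsets n) ++ map (inside ∷_) (allSubsets n))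
    ≡⟨ length-++ (map (outside ∷_) (allSubsets n)) ⟩
  length (map (outside ∷_) (allSubsets n)) + length (map (inside ∷_) (allSubsets n))
    ≡⟨ cong₂ _+_ (length-map _ (allSubsets n)) (length-map _ (allSubsets n)) ⟩
  length (allSubsets n) + length (allSubsets n)
    ≡⟨ cong (λ k → k + k) (length-allSubsets n) ⟩
  2 ^ n + 2 ^ n
    ≡⟨ cong (2 ^ n +_) (sym (+-identityʳ (2 ^ n))) ⟩
  2 ^ suc n ∎
  where open ≡-Reasoning

allSubsets-unique : ∀ n → Unique (allSubsets n)
allSubsets-unique zero = [] ∷ []
allSubsets-unique (suc n) =
  Unique.++⁺ (Unique.map⁺ ∷-injectiveʳ (allSubsets-unique n))
             (Unique.map⁺ ∷-injectiveʳ (allSubsets-unique n))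
             disjoint
  where
  disjoint : ∀ {S} → S ∈ map (outside ∷_) (allSubsets n) × S ∈ map (inside ∷_) (allSubsets n) → ⊥
  disjoint (S∈out , S∈in) with ∈-map⁻ (outside ∷_) S∈out | ∈-map⁻ (inside ∷_) S∈in
  ... | _ , _ , refl | _ , _ , ()

-- All 2^n sets containing the first element would each count towards its degree.
degree<2^n⇒∃∉ : ∀ {n} (F : Family (suc n)) → degree F < 2 ^ n → ∃ (_∉ F)
degree<2^n⇒∃∉ {n} F degreeF<2^n with All.all? (λ X → (inside ∷ X) ∈? F) (allSubsets n)
... | no ¬all with find (¬All⇒Any¬ (λ X → (inside ∷ X) ∈? F) (allSubsets n) ¬all)
...   | X , _ , X∉F = inside ∷ X , X∉F
degree<2^n⇒∃∉ {n} F degreeF<2^n | yes all =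
  contradiction degreeF<2^n (≤⇒≯ (≤-trans 2^n≤mₑ (mₑ≤degree zero F)))
  where
  insideSets : Family (suc n)
  insideSets = map (inside ∷_) (allSubsets n)

  insideSets⊆ : ∀ {S} → S ∈ insideSets → S ∈ filter (zero ∈ₛ?_) F
  insideSets⊆ S∈ with ∈-map⁻ (inside ∷_) S∈
  ... | _ , X∈ , refl = ∈-filter⁺ (zero ∈ₛ?_) (All.lookup all X∈) here

  2^n≤mₑ : 2 ^ n ≤ mₑ zero F
  2^n≤mₑ = begin
    2 ^ n                 ≡⟨ sym (length-allSubsets n) ⟩
    length (allSubsets n) ≡⟨ sym (length-map _ (allSubsets n)) ⟩
    length insideSets     ≤⟨ unique-⊆⇒length≤ (Unique.map⁺ ∷-injectiveʳ (allSubsets-unique n)) insideSets⊆ ⟩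
    mₑ zero F             ∎
    where open ≤-Reasoning

Extends : ∀ {n} → Family n → Subset n → Set
Extends F X = X ∉ F × (∀ {T} → T ∈ F → X ∪ T ∈ X ∷ F)

-- Enlarge a non-member by members of F for as long as the union stays outside F.
∉⇒∃-Extends : ∀ {n} {F : Family n} {S} → S ∉ F → ∃ (Extends F)
∉⇒∃-Extends {F = F} {S} = go S (⊃-wellFounded S)
  where
  go : ∀ S → Acc _⊃_ S → S ∉ F → ∃ (Extends F)
  go S (acc smaller) S∉F with All.all? (λ T → (S ∪ T) ∈? (S ∷ F)) F
  ... | yes closed = S , S∉F , All.lookup closed
  ... | no ¬closed with find (¬All⇒Any¬ (λ T → (S ∪ T) ∈? (S ∷ F)) F ¬closed)
  ...   | T , _ , S∪T∉ = go (S ∪ T) (smaller S⊂S∪T) (λ S∪T∈F → S∪T∉ (there S∪T∈F))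
    where
    S⊂S∪T : S ⊂ S ∪ T
    S⊂S∪T = ⊆∧≢⇒⊂ (p⊆p∪q T) (λ S≡S∪T → S∪T∉ (here (sym S≡S∪T)))

Extends⇒UCFamily : ∀ {n} {F : Family n} {X} → UCFamily F → Extends F X → UCFamily (X ∷ F)
Extends⇒UCFamily {F = F} {X} (uniqueF , closedF) (X∉F , absorbs) = uniqueX∷F , closed
  where
  uniqueX∷F : Unique (X ∷ F)
  uniqueX∷F = All.tabulate (λ S∈F X≡S → X∉F (subst (_∈ F) (sym X≡S) S∈F)) ∷ uniqueF

  closed : UnionClosed (X ∷ F)
  closed (here refl) (here refl) = here (∪-idem X)
  closed (here refl) (there T∈F) = absorbs T∈F
  closed {S} (there S∈F) (here refl) = subst (_∈ X ∷ F) (∪-comm X S) (absorbs S∈F)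
  closed (there S∈F) (there T∈F) = there (closedF S∈F T∈F)

UCFamily-extend : ∀ {n} {F : Family (suc n)} → UCFamily F → degree F < 2 ^ n →
                  ∃ λ X → UCFamily (X ∷ F)
UCFamily-extend {F = F} ucF degreeF<2^n with degree<2^n⇒∃∉ F degreeF<2^n
... | _ , S∉F with ∉⇒∃-Extends S∉F
...   | X , extendsX = X , Extends⇒UCFamily ucF extendsX

∃-⊂-minimal : ∀ {n} (S : Subset n) (F : Family n) →
              ∃ λ X → X ∈ S ∷ F × (∀ {T} → T ∈ S ∷ F → ¬ T ⊂ X)
∃-⊂-minimal {n} S F = X , X∈S∷F , λ T∈ T⊂X → <⇒≱ (p⊂q⇒∣p∣<∣q∣ T⊂X) (All.lookup ∣X∣≤ T∈)
  where
  X : Subset n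
  X = Extrema.argmin ∣_∣ S F
  X∈S∷F : X ∈ S ∷ F
  X∈S∷F = Extrema.argmin-all ∣_∣ (here refl) (All.tabulate there)
  ∣X∣≤ : All (λ T → ∣ X ∣ ≤ ∣ T ∣) (S ∷ F)
  ∣X∣≤ = Extrema.f[argmin]≤f[⊤] {f = ∣_∣} S F ∷ Extrema.f[argmin]≤f[xs] {f = ∣_∣} S F

-- A union equal to X would contain a set properly inside X.
∖-minimal-UnionClosed : ∀ {n} {F : Family n} {X} → UnionClosed F → (∀ {T} → T ∈ F → ¬ T ⊂ X) →
                        UnionClosed (F ∖ X)
∖-minimal-UnionClosed closedF minimal {S} {T} S∈ T∈ with ∈-∖⁻ S∈ | ∈-∖⁻ T∈
... | S∈F , S≢X | T∈F , _ = ∈-∖⁺ (closedF S∈F T∈F) λ S∪T≡X →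
  minimal S∈F (⊆∧≢⇒⊂ (subst (S ⊆_) S∪T≡X (p⊆p∪q T)) S≢X)

UCFamily-shrink : ∀ {n} {G : Family n} {M} → UCFamily G → m G ≡ suc M →
                  ∃ λ (R : Family n) → UCFamily R × m R ≡ M × degree R ≤ degree G
UCFamily-shrink {G = []} _ ()
UCFamily-shrink {n} {G = S ∷ F} {M} (uniqueG , closedG) mG≡1+M with ∃-⊂-minimal S F
... | X , X∈G , minimal = G∖X , (uniqueG∖X , ∖-minimal-UnionClosed closedG minimal) , mG∖X≡M ,
                         degree-mono uniqueG∖X (λ T∈ → proj₁ (∈-∖⁻ T∈))
  where
  G∖X : Family n
  G∖X = (S ∷ F) ∖ X
  uniqueG∖X : Unique G∖X
  uniqueG∖X = Unique-∖ uniqueG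
  mG∖X≡M : m G∖X ≡ M
  mG∖X≡M = suc-injective (trans (length-∖ uniqueG X∈G) mG≡1+M)

f[n,a]≤f[1+n,a] : ∀ {n a k k′} → IsF n a k → IsF (suc n) a k′ → k ≤ k′
f[n,a]≤f[1+n,a] ((F , ucF , F≢[] , degreeF≤a , refl) , _) (_ , maximal) =
  subst (_≤ _) (length-map _ F)
    (maximal (embed F) (embed-UCFamily ucF) (embed-≢[] F≢[]) (≤-trans (degree-embed F) degreeF≤a))

g[1+n,m]≤g[n,m] : ∀ {n M j j′} → IsG n M j → IsG (suc n) M j′ → j′ ≤ j
g[1+n,m]≤g[n,m] (_ , (F , ucF , mF≡M , refl) , _) (_ , _ , minimal) =
  ≤-trans (minimal (embed F) (embed-UCFamily ucF) (trans (length-map _ F) mF≡M)) (degree-embed F)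

degree<a⇒m<f[1+n,a] : ∀ {n a k} {G : Family (suc n)} → a ≤ 2 ^ n → IsF (suc n) a k →
                      UCFamily G → degree G < a → m G < k
degree<a⇒m<f[1+n,a] {G = G} a≤2^n (_ , maximal) ucG degreeG<a
  with UCFamily-extend ucG (<-≤-trans degreeG<a a≤2^n)
... | X , ucX∷G = maximal (X ∷ G) ucX∷G (λ ()) (≤-trans (degree-∷ X G) degreeG<a)

f[n,a]<f[n,1+a] : ∀ {n a k k′} → a < 2 ^ n → IsF (suc n) a k → IsF (suc n) (suc a) k′ → k < k′
f[n,a]<f[n,1+a] a<2^n ((F , ucF , _ , degreeF≤a , refl) , _) isF′ =
  degree<a⇒m<f[1+n,a] a<2^n isF′ ucF (s≤s degreeF≤a)

g[n,m]≤g[n,1+m] : ∀ {n M j j′} → IsG n M j → IsG n (suc M) j′ → j ≤ j′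
g[n,m]≤g[n,1+m] (_ , _ , minimal) (_ , (G , ucG , mG≡1+M , refl) , _) with UCFamily-shrink ucG mG≡1+M
... | R , ucR , mR≡M , degreeR≤degreeG = ≤-trans (minimal R ucR mR≡M) degreeR≤degreeG

g[n,f[n,a]]≡a : ∀ {n a k j} → a < 2 ^ n → IsF (suc n) a k → IsG (suc n) k j → j ≡ a
g[n,f[n,a]]≡a a<2^n isF@((F , ucF , _ , degreeF≤a , mF≡k) , _) (_ , (G , ucG , mG≡k , degreeG≡j) , minimal) =
  ≤-antisym (≤-trans (minimal F ucF mF≡k) degreeF≤a) (≮⇒≥ λ j<a →
    <-irrefl mG≡k (degree<a⇒m<f[1+n,a] (<⇒≤ a<2^n) isF ucG (subst (_< _) (sym degreeG≡j) j<a)))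

m≤f[n,g[n,m]] : ∀ {n M j k} → IsG n M j → IsF n j k → M ≤ k
m≤f[n,g[n,m]] (() , ([] , _ , refl , _) , _) _
m≤f[n,g[n,m]] (_ , (S ∷ F , ucF , refl , degreeF≡j) , _) (_ , maximal) =
  maximal (S ∷ F) ucF (λ ()) (≤-reflexive degreeF≡j)

⌈log₂n⌉+1≤k⇒n<2^k : ∀ {n k} → ⌈log₂ n ⌉ + 1 ≤ k → n < 2 ^ k
⌈log₂n⌉+1≤k⇒n<2^k {n} {k} ⌈log₂n⌉+1≤k = ≰⇒> λ 2^k≤n → m+1+n≰m ⌈log₂ n ⌉ (begin
  ⌈log₂ n ⌉ + 1     ≤⟨ ⌈log₂n⌉+1≤k ⟩
  k                 ≡⟨ sym (⌈log₂2^n⌉≡n k) ⟩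
  ⌈log₂ (2 ^ k) ⌉   ≤⟨ ⌈log₂⌉-mono-≤ 2^k≤n ⟩
  ⌈log₂ n ⌉         ∎)
  where open ≤-Reasoning

-- Only parts (3) and (5) need their bound on n; the others hold for every n.
proposition2p1 : (∀ (a n : ℕ) → 1 ≤ a → 1 ≤ n → n ≥ ⌈log₂ a ⌉ + 1 →
    ∀ k k′ → IsF n a k → IsF (suc n) a k′ → k ≤ k′)
    × (∀ (M n : ℕ) → 1 ≤ M → 1 ≤ n → n ≥ ⌈log₂ M ⌉ →
    ∀ j j′ → IsG n M j → IsG (suc n) M j′ → j ≥ j′)
    × (∀ (a n : ℕ) → 1 ≤ a → 1 ≤ n → n > ⌈log₂ a ⌉ + 1 →
    ∀ k k′ → IsF n a k → IsF n (suc a) k′ → k < k′)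
    × (∀ (M n : ℕ) → 1 ≤ M → 1 ≤ n → n ≥ ⌈log₂ M ⌉ →
    ∀ j j′ → IsG n M j → IsG n (suc M) j′ → j ≤ j′)
    × (∀ (a n : ℕ) → 1 ≤ a → 1 ≤ n → n > ⌈log₂ a ⌉ + 1 →
    ∀ k j → IsF n a k → IsG n k j → j ≡ a)
    × (∀ (M n : ℕ) → 1 ≤ M → 1 ≤ n → n ≥ ⌈log₂ M ⌉ →
    ∀ j k → IsG n M j → IsF n j k → k ≥ M)
proposition2p1 =
    (λ _ _ _ _ _ _ _ → f[n,a]≤f[1+n,a])
  , (λ _ _ _ _ _ _ _ → g[1+n,m]≤g[n,m])
  , (λ { _ (suc _) _ _ (s≤s bound) _ _ → f[n,a]<f[n,1+a] (⌈log₂n⌉+1≤k⇒n<2^k bound) })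
  , (λ _ _ _ _ _ _ _ → g[n,m]≤g[n,1+m])
  , (λ { _ (suc _) _ _ (s≤s bound) _ _ → g[n,f[n,a]]≡a (⌈log₂n⌉+1≤k⇒n<2^k bound) })
  , (λ _ _ _ _ _ _ _ → m≤f[n,g[n,m]])
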